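{- The values of $n_3(3,d,1)$ for $d=1,2,\dots,15$ are, in order, $6,6,8,8,11,12,14,14,16,16,18,18,21,22,24$; moreover $n_3(3,17,1)=26$ and $n_3(3,21,1)=32$; and $n_3(3,d,1)=n_3(3,d)$ for all other positive integers $d$.
   Context: An $[n,k,d]_q$-code is a $k$-dimensional subspace of $\mathbb{F}_q^n$ with minimum Hamming distance at least $d$. $n_q(k,d)$ denotes the minimum length $n$ of an $[n,k,d]_q$-code. A linear code $C\subseteq\mathbb{F}_q^n$ has locality $r$ if for every coordinate $i$ there is a set $S_i\subseteq\{1,\dots,n\}\setminus\{i\}$ with $|S_i|\le r$ such that any two codewords agreeing on all coordinates in $S_i$ also agree in coordinate $i$. $n_q(k,d,r)$ denotes the minimum length $n$ of an $[n,k,d]_q$-code with locality $r$. -}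

module Defs where

open import Data.Nat using (ℕ; zero; suc; _+_; _*_; _≤_; _<_)
open import Data.Nat.DivMod using (_mod_)
open import Data.Fin using (Fin; toℕ)
import Data.Fin as F
open import Data.Fin.Subset using (Subset; _∈_; _∉_; ∣_∣)
open import Data.Product using (Σ; ∃; _×_; _,_)
open import Relation.Binary.PropositionalEquality using (_≡_; _≢_)
open import Relation.Nullary using (¬_; yes; no)

F3 : Set
F3 = Fin 3

0₃ : F3
0₃ = F.zero

_+₃_ : F3 → F3 → F3
a +₃ b = (toℕ a + toℕ b) mod 3

_*₃_ : F3 → F3 → F3
a *₃ b = (toℕ a * toℕ b) mod 3

sum₃ : ∀ {k} → (Fin k → F3) → F3
sum₃ {zero}  f = 0₃
sum₃ {suc k} f = f F.zero +₃ sum₃ (λ i → f (F.suc i))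

hdist : ∀ {n} → (Fin n → F3) → (Fin n → F3) → ℕ
hdist {zero}  x y = 0
hdist {suc n} x y with x F.zero F.≟ y F.zero
... | yes _ = hdist (λ j → x (F.suc j)) (λ j → y (F.suc j))
... | no  _ = suc (hdist (λ j → x (F.suc j)) (λ j → y (F.suc j)))

-- Linear codes over F₃, given by a k × n generator matrix G whose rows
-- form a basis of the code (so the code is the k-dimensional subspace
-- { m·G : m ∈ F₃^k } of F₃^n).

Matrix : ℕ → ℕ → Set
Matrix k n = Fin k → Fin n → F3

encode : ∀ {k n} → Matrix k n → (Fin k → F3) → (Fin n → F3)
encode G m j = sum₃ (λ i → m i *₃ G i j)

LinIndepRows : ∀ {k n} → Matrix k n → Set
LinIndepRows {k} G =
  ∀ (m : Fin k → F3) → (∀ j → encode G m j ≡ 0₃) → ∀ i → m i ≡ 0₃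

MinDistAtLeast : ∀ {k n} → Matrix k n → ℕ → Set
MinDistAtLeast {k} G d =
  ∀ (m m' : Fin k → F3) → ¬ (∀ i → m i ≡ m' i) →
  d ≤ hdist (encode G m) (encode G m')

HasLocality : ∀ {k n} → Matrix k n → ℕ → Set
HasLocality {k} {n} G r =
  ∀ (i : Fin n) → Σ (Subset n) λ S →
    i ∉ S × ∣ S ∣ ≤ r ×
    (∀ (m m' : Fin k → F3) →
       (∀ j → j ∈ S → encode G m j ≡ encode G m' j) →
       encode G m i ≡ encode G m' i)

CodeExists : ℕ → ℕ → ℕ → Set
CodeExists n k d =
  Σ (Matrix k n) λ G → LinIndepRows G × MinDistAtLeast G d

LRCExists : ℕ → ℕ → ℕ → ℕ → Set
LRCExists n k d r =
  Σ (Matrix k n) λ G → LinIndepRows G × MinDistAtLeast G d × HasLocality G r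

IsLeast : (ℕ → Set) → ℕ → Set
IsLeast P m = P m × (∀ n → n < m → ¬ P n)

n3≡ : ℕ → ℕ → ℕ → Set
n3≡ k d m = IsLeast (λ n → CodeExists n k d) m

n3loc≡ : ℕ → ℕ → ℕ → ℕ → Set
n3loc≡ k d r m = IsLeast (λ n → LRCExists n k d r) m

{-# OPTIONS --safe #-}
module Submission where

-- A linear [n,3,d]₃ code is determined, up to zero columns and column scalings, by the multiset a
-- of points of PG(2,3) spanned by its columns. The codeword of a message δ ≠ 0 is nonzero exactly at
-- the columns off the line δ⊥, so the minimum distance is at least d iff every line misses at least
-- d points of a, and locality 1 holds iff no point of a has multiplicity 1 (a coordinate can only be
-- recovered from a single other one if that column spans the same point). Counting over the four
-- lines through a point gives the Griesmer bound n ≥ d + ⌈d/3⌉ + ⌈d/9⌉. For d ≥ 16, d ∉ {17, 21},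
-- explicit multisets with no point of multiplicity 1 attain it, so n₃(3,d,1) = n₃(3,d); for the other d
-- explicit multisets give the upper bounds and a branch-and-bound search over multiplicity vectors
-- (or the Griesmer bound) excludes shorter codes.

open import Defs
open import Data.Nat using (ℕ; _≤_)
open import Data.Product using (_×_)
open import Relation.Binary.PropositionalEquality using (_≢_)

open import Data.Bool using (Bool; true; false; T; _∨_; if_then_else_)
import Data.Bool as Bool
open import Data.Bool.ListAction using (any; all)
open import Data.Bool.Properties using (T-∨)
open import Data.Empty using (⊥-elim)
open import Data.Fin using (Fin; zero; suc; toℕ; #_; _↑ˡ_; _↑ʳ_; splitAt; punchIn)
import Data.Fin as Fin
open import Data.Fin.Properties using (all?; any?)
import Data.Fin.Properties as Finₚ
open import Data.Fin.Subset using (Subset; ∁; ∣_∣; _∈_; ⁅_⁆)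
open import Data.Fin.Subset.Properties using (nonempty?; x∈p∧x≢y⇒x∈p-y; x∈p⇒∣p-x∣<∣p∣; x∈⁅x⁆; x∈⁅y⁆⇒x≡y; ∣⁅x⁆∣≡1)
open import Data.List using (List; []; _∷_; _++_; foldr; filter; length; allFin; upTo)
import Data.List as List
import Data.List.Properties as Listₚ
open import Data.List.Extrema.Nat using (argmin; f[argmin]≤f[xs])
open import Data.List.Membership.Propositional.Properties using (∈-allFin; ∈-upTo⁺)
open import Data.List.Relation.Unary.All as Allₗ using ([]; _∷_)
open import Data.List.Relation.Unary.All.Properties using (all⁺; ++⁺; tabulate⁺)
import Data.List.Relation.Unary.Any as Any
open import Data.List.Relation.Unary.Any.Properties using (any⁻)
open import Data.Maybe using (Maybe; just; nothing; maybe)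
import Data.Maybe as Maybe
import Data.Maybe.Properties as Maybe
open import Data.Nat using (zero; suc; _+_; _*_; _∸_; _<_; z≤n; s≤s; _≤ᵇ_; _<ᵇ_; _≡ᵇ_)
import Data.Nat as ℕ
open import Data.Nat.DivMod using (_mod_)
import Data.Nat.ListAction as ℕₗ
open import Data.Nat.Properties
open import Algebra.Properties.CommutativeSemigroup +-commutativeSemigroup using (interchange; x∙yz≈y∙xz)
open import Data.Nat.Solver using (module +-*-Solver)
open import Data.Product using (∃; _,_)
open import Data.Sum using (_⊎_; inj₁; inj₂; [_,_]′)
open import Data.Vec using (Vec; []; _∷_; lookup; replicate; tabulate; zipWith; sum; map)
open import Data.Vec.Properties as Vecₚ using (zipWith-identityˡ; zipWith-assoc; lookup-zipWith; lookup-replicate)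
open import Data.Vec.Relation.Unary.All as All using (All; []; _∷_)
open import Data.Vec.Relation.Unary.All.Properties using (lookup⁻)
open import Function using (_∘_; const)
open import Function.Bundles using (Equivalence)
open import Relation.Binary using (tri<; tri≈; tri>)
open import Relation.Binary.PropositionalEquality
open import Relation.Nullary using (¬_; Dec; yes; no; ¬?; _×-dec_; _→-dec_)
open import Relation.Nullary.Decidable using (True; toWitness; isNo)
open import Relation.Nullary.Negation using (contradiction)

open +-*-Solver using (solve; _:+_; _:*_; con; _:=_)

private
  variable
    k m n : ℕ

-- Multisets as multiplicity vectors

infixl 6 _+ᵥ_

_+ᵥ_ : Vec ℕ n → Vec ℕ n → Vec ℕ n
_+ᵥ_ = zipWith _+_

0ᵥ : Vec ℕ n
0ᵥ = replicate _ 0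

+ᵥ-identityˡ : (a : Vec ℕ n) → 0ᵥ +ᵥ a ≡ a
+ᵥ-identityˡ = zipWith-identityˡ +-identityˡ

+ᵥ-assoc : (a b c : Vec ℕ n) → a +ᵥ b +ᵥ c ≡ a +ᵥ (b +ᵥ c)
+ᵥ-assoc = zipWith-assoc +-assoc

sum-0ᵥ : ∀ n → sum (0ᵥ {n}) ≡ 0
sum-0ᵥ zero = refl
sum-0ᵥ (suc n) = sum-0ᵥ n

sum-+ᵥ : (a b : Vec ℕ n) → sum (a +ᵥ b) ≡ sum a + sum b
sum-+ᵥ [] [] = refl
sum-+ᵥ (x ∷ a) (y ∷ b) rewrite sum-+ᵥ a b = interchange x y (sum a) (sum b)

select : Bool → ℕ → ℕ
select s x = if s then x else 0

mass : Subset n → Vec ℕ n → ℕ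
mass [] [] = 0
mass (s ∷ p) (x ∷ a) = select s x + mass p a

mass-+ᵥ : ∀ (p : Subset n) a b → mass p (a +ᵥ b) ≡ mass p a + mass p b
mass-+ᵥ [] [] [] = refl
mass-+ᵥ (true ∷ p) (x ∷ a) (y ∷ b) rewrite mass-+ᵥ p a b = interchange x y (mass p a) (mass p b)
mass-+ᵥ (false ∷ p) (x ∷ a) (y ∷ b) = mass-+ᵥ p a b

mass-0ᵥ : ∀ (p : Subset n) → mass p 0ᵥ ≡ 0
mass-0ᵥ [] = refl
mass-0ᵥ (true ∷ p) = mass-0ᵥ p
mass-0ᵥ (false ∷ p) = mass-0ᵥ p

mass-∁ : ∀ (p : Subset n) a → mass (∁ p) a + mass p a ≡ sum a
mass-∁ [] [] = refl
mass-∁ (true ∷ p) (x ∷ a) = begin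
  mass (∁ p) a + (x + mass p a) ≡⟨ x∙yz≈y∙xz (mass (∁ p) a) x (mass p a) ⟩
  x + (mass (∁ p) a + mass p a) ≡⟨ cong (x +_) (mass-∁ p a) ⟩
  x + sum a                     ∎
  where open ≡-Reasoning
mass-∁ (false ∷ p) (x ∷ a) = trans (+-assoc x _ _) (cong (x +_) (mass-∁ p a))

mass≤sum : ∀ (p : Subset n) a → mass p a ≤ sum a
mass≤sum [] [] = z≤n
mass≤sum (true ∷ p) (x ∷ a) = +-monoʳ-≤ x (mass≤sum p a)
mass≤sum (false ∷ p) (x ∷ a) = m≤n⇒m≤o+n x (mass≤sum p a)

mass-bound : ∀ {j K} (p : Subset n) {a} → All (λ x → x + j ≤ K) a → mass p a + ∣ p ∣ * j ≤ ∣ p ∣ * K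
mass-bound [] [] = z≤n
mass-bound {j = j} {K} (true ∷ p) {x ∷ a} (x+j≤K ∷ bounds) = begin
  x + mass p a + (j + ∣ p ∣ * j) ≡⟨ interchange x (mass p a) j (∣ p ∣ * j) ⟩
  x + j + (mass p a + ∣ p ∣ * j) ≤⟨ +-mono-≤ x+j≤K (mass-bound p bounds) ⟩
  K + ∣ p ∣ * K                   ∎
  where open ≤-Reasoning
mass-bound (false ∷ p) (_ ∷ bounds) = mass-bound p bounds

mass≤∣p∣*B : ∀ {B} (p : Subset n) {a} → All (_≤ B) a → mass p a ≤ ∣ p ∣ * B
mass≤∣p∣*B {B = B} p {a} a≤B = begin
  mass p a             ≡⟨ sym (trans (cong (mass p a +_) (*-zeroʳ ∣ p ∣)) (+-identityʳ (mass p a))) ⟩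
  mass p a + ∣ p ∣ * 0 ≤⟨ mass-bound p (All.map (λ {x} → ≤-trans (≤-reflexive (+-identityʳ x))) a≤B) ⟩
  ∣ p ∣ * B            ∎
  where open ≤-Reasoning

once : Maybe (Fin n) → Vec ℕ n
once nothing = 0ᵥ
once (just zero) = 1 ∷ 0ᵥ
once (just (suc i)) = 0 ∷ once (just i)

sum-once≤1 : (x : Maybe (Fin n)) → sum (once x) ≤ 1
sum-once≤1 {n} nothing = subst (_≤ 1) (sym (sum-0ᵥ n)) z≤n
sum-once≤1 {suc n} (just zero) = ≤-reflexive (cong suc (sum-0ᵥ n))
sum-once≤1 (just (suc i)) = sum-once≤1 (just i)

lookup-once-≡ : ∀ (i : Fin n) → lookup (once (just i)) i ≡ 1
lookup-once-≡ zero = refl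
lookup-once-≡ (suc i) = lookup-once-≡ i

lookup-once-≢ : ∀ (x : Maybe (Fin n)) i → x ≢ just i → lookup (once x) i ≡ 0
lookup-once-≢ nothing i _ = lookup-replicate i 0
lookup-once-≢ (just zero) zero x≢i = contradiction refl x≢i
lookup-once-≢ (just zero) (suc i) _ = lookup-replicate i 0
lookup-once-≢ (just (suc x)) zero _ = refl
lookup-once-≢ (just (suc x)) (suc i) x≢i = lookup-once-≢ (just x) i (x≢i ∘ cong (Maybe.map suc))

histogram : (Fin n → Maybe (Fin m)) → Vec ℕ m
histogram {zero} f = 0ᵥ
histogram {suc n} f = once (f zero) +ᵥ histogram (f ∘ suc)

lookup-histogram : ∀ (f : Fin (suc n) → Maybe (Fin m)) i →
  lookup (histogram f) i ≡ lookup (once (f zero)) i + lookup (histogram (f ∘ suc)) i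
lookup-histogram f i = lookup-zipWith _+_ i (once (f zero)) (histogram (f ∘ suc))

sum-histogram≤ : ∀ (f : Fin n → Maybe (Fin m)) → sum (histogram f) ≤ n
sum-histogram≤ {zero} {m} f = ≤-reflexive (sum-0ᵥ m)
sum-histogram≤ {suc n} f = begin
  sum (once (f zero) +ᵥ histogram (f ∘ suc))     ≡⟨ sum-+ᵥ (once (f zero)) (histogram (f ∘ suc)) ⟩
  sum (once (f zero)) + sum (histogram (f ∘ suc)) ≤⟨ +-mono-≤ (sum-once≤1 (f zero)) (sum-histogram≤ (f ∘ suc)) ⟩
  suc n                                           ∎
  where open ≤-Reasoning

histogram-preimage : ∀ (f : Fin n → Maybe (Fin m)) i → lookup (histogram f) i ≢ 0 → ∃ λ j → f j ≡ just i
histogram-preimage {zero} {m} f i h = contradiction (lookup-replicate i 0) h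
histogram-preimage {suc n} f i h with Maybe.≡-dec Fin._≟_ (f zero) (just i)
... | yes f0≡i = zero , f0≡i
... | no f0≢i = let j , fj≡i = histogram-preimage (f ∘ suc) i h′ in suc j , fj≡i
  where
  h′ : lookup (histogram (f ∘ suc)) i ≢ 0
  h′ rewrite lookup-histogram f i | lookup-once-≢ (f zero) i f0≢i = h

histogram-≥1 : ∀ (f : Fin n → Maybe (Fin m)) {i} j → f j ≡ just i → 1 ≤ lookup (histogram f) i
histogram-≥1 f {i} zero f0≡i rewrite lookup-histogram f i | f0≡i | lookup-once-≡ i = s≤s z≤n
histogram-≥1 f {i} (suc j) fj≡i rewrite lookup-histogram f i =
  m≤n⇒m≤o+n _ (histogram-≥1 (f ∘ suc) j fj≡i)

histogram-≥2 : ∀ (f : Fin n → Maybe (Fin m)) {i j j′} → j ≢ j′ → f j ≡ just i → f j′ ≡ just i →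
  2 ≤ lookup (histogram f) i
histogram-≥2 f {j = zero} {zero} j≢j′ _ _ = contradiction refl j≢j′
histogram-≥2 f {i} {zero} {suc j′} _ f0≡i fj′≡i rewrite lookup-histogram f i | f0≡i | lookup-once-≡ i =
  s≤s (histogram-≥1 (f ∘ suc) j′ fj′≡i)
histogram-≥2 f {i} {suc j} {zero} _ fj≡i f0≡i rewrite lookup-histogram f i | f0≡i | lookup-once-≡ i =
  s≤s (histogram-≥1 (f ∘ suc) j fj≡i)
histogram-≥2 f {i} {suc j} {suc j′} j≢j′ fj≡i fj′≡i rewrite lookup-histogram f i =
  m≤n⇒m≤o+n _ (histogram-≥2 (f ∘ suc) (j≢j′ ∘ cong suc) fj≡i fj′≡i)

histogram-no-singletons : ∀ (f : Fin n → Maybe (Fin m)) →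
  (∀ j {i} → f j ≡ just i → ∃ λ j′ → j′ ≢ j × f j′ ≡ just i) → All (_≢ 1) (histogram f)
histogram-no-singletons f twin = lookup⁻ no-singleton
  where
  no-singleton : ∀ i → lookup (histogram f) i ≢ 1
  no-singleton i h =
    let j , fj≡i = histogram-preimage f i (λ h0 → 0≢1+n (trans (sym h0) h))
        j′ , j′≢j , fj′≡i = twin j fj≡i
    in <-irrefl (sym h) (histogram-≥2 f j′≢j fj′≡i fj≡i)

histogram-cong : ∀ {f g : Fin n → Maybe (Fin m)} → (∀ i → f i ≡ g i) → histogram f ≡ histogram g
histogram-cong {zero} f≗g = refl
histogram-cong {suc n} f≗g = cong₂ _+ᵥ_ (cong once (f≗g zero)) (histogram-cong (f≗g ∘ suc))

histogram-↑ : ∀ {m n} (f : Fin (m + n) → Maybe (Fin k)) →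
  histogram f ≡ histogram (f ∘ (_↑ˡ n)) +ᵥ histogram (f ∘ (m ↑ʳ_))
histogram-↑ {m = zero} f = sym (+ᵥ-identityˡ (histogram f))
histogram-↑ {m = suc m} {n} f = begin
  once (f zero) +ᵥ histogram (f ∘ suc)
    ≡⟨ cong (once (f zero) +ᵥ_) (histogram-↑ {m = m} (f ∘ suc)) ⟩
  once (f zero) +ᵥ (histogram (f ∘ suc ∘ (_↑ˡ n)) +ᵥ histogram (f ∘ suc ∘ (m ↑ʳ_)))
    ≡⟨ sym (+ᵥ-assoc (once (f zero)) _ _) ⟩
  once (f zero) +ᵥ histogram (f ∘ suc ∘ (_↑ˡ n)) +ᵥ histogram (f ∘ suc ∘ (m ↑ʳ_)) ∎
  where open ≡-Reasoning

histogram-map-suc : ∀ (f : Fin n → Maybe (Fin m)) → histogram (Maybe.map suc ∘ f) ≡ 0 ∷ histogram f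
histogram-map-suc {zero} f = refl
histogram-map-suc {suc n} f = cong₂ _+ᵥ_ (once-map-suc (f zero)) (histogram-map-suc (f ∘ suc))
  where
  once-map-suc : ∀ (x : Maybe (Fin m)) → once (Maybe.map suc x) ≡ 0 ∷ once x
  once-map-suc nothing = refl
  once-map-suc (just i) = refl

histogram-const-zero : ∀ {m} k → histogram {k} (const (just zero)) ≡ k ∷ 0ᵥ {m}
histogram-const-zero zero = refl
histogram-const-zero {m} (suc k) rewrite histogram-const-zero {m} k = cong (suc k ∷_) (+ᵥ-identityˡ 0ᵥ)

block : (a : Vec ℕ k) → Fin (sum a) → Fin k
block (x ∷ a) i = [ const zero , suc ∘ block a ]′ (splitAt x i)

block-↑ˡ : ∀ x (a : Vec ℕ k) i → block (x ∷ a) (i ↑ˡ sum a) ≡ zero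
block-↑ˡ x a i rewrite Finₚ.splitAt-↑ˡ x i (sum a) = refl

block-↑ʳ : ∀ x (a : Vec ℕ k) i → block (x ∷ a) (x ↑ʳ i) ≡ suc (block a i)
block-↑ʳ x a i rewrite Finₚ.splitAt-↑ʳ x (sum a) i = refl

histogram-block : (a : Vec ℕ k) → histogram (just ∘ block a) ≡ a
histogram-block [] = refl
histogram-block (x ∷ a) = begin
  histogram (just ∘ block (x ∷ a))
    ≡⟨ histogram-↑ {m = x} (just ∘ block (x ∷ a)) ⟩
  histogram (just ∘ block (x ∷ a) ∘ (_↑ˡ sum a)) +ᵥ histogram (just ∘ block (x ∷ a) ∘ (x ↑ʳ_))
    ≡⟨ cong₂ _+ᵥ_ (histogram-cong (cong just ∘ block-↑ˡ x a)) (histogram-cong (cong just ∘ block-↑ʳ x a)) ⟩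
  histogram {x} (const (just zero)) +ᵥ histogram (Maybe.map suc ∘ just ∘ block a)
    ≡⟨ cong₂ _+ᵥ_ (histogram-const-zero x) (histogram-map-suc (just ∘ block a)) ⟩
  (x ∷ 0ᵥ) +ᵥ (0 ∷ histogram (just ∘ block a))
    ≡⟨ cong₂ _∷_ (+-identityʳ x) (trans (+ᵥ-identityˡ _) (histogram-block a)) ⟩
  x ∷ a ∎
  where open ≡-Reasoning

another : ∀ {x} → x ≢ 1 → (i : Fin x) → ∃ λ j → j ≢ i
another {suc zero} x≢1 _ = contradiction refl x≢1
another {suc (suc _)} _ i = punchIn i zero , Finₚ.punchInᵢ≢i i zero

block-twin : ∀ {a : Vec ℕ k} → All (_≢ 1) a → ∀ i → ∃ λ j → j ≢ i × block a j ≡ block a i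
block-twin {a = x ∷ a} (x≢1 ∷ no1) i with splitAt x i in eq
... | inj₁ i′ = let j′ , j′≢i′ = another x≢1 i′ in
  j′ ↑ˡ sum a ,
  (λ j≡i → j′≢i′ (Finₚ.↑ˡ-injective (sum a) j′ i′ (trans j≡i (sym (Finₚ.splitAt⁻¹-↑ˡ eq))))) ,
  block-↑ˡ x a j′
... | inj₂ i′ = let j′ , j′≢i′ , same = block-twin no1 i′ in
  x ↑ʳ j′ ,
  (λ j≡i → j′≢i′ (Finₚ.↑ʳ-injective x j′ i′ (trans j≡i (sym (Finₚ.splitAt⁻¹-↑ʳ eq))))) ,
  trans (block-↑ʳ x a j′) (cong suc same)

⟪_,_⟫ : Vec ℕ n → Vec ℕ n → ℕ
⟪ c , a ⟫ = sum (zipWith _*_ c a)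

⟪⟫-zeroˡ : (a : Vec ℕ n) → ⟪ 0ᵥ , a ⟫ ≡ 0
⟪⟫-zeroˡ [] = refl
⟪⟫-zeroˡ (x ∷ a) = ⟪⟫-zeroˡ a

⟪⟫-distribˡ-+ᵥ : ∀ (c c′ a : Vec ℕ n) → ⟪ c +ᵥ c′ , a ⟫ ≡ ⟪ c , a ⟫ + ⟪ c′ , a ⟫
⟪⟫-distribˡ-+ᵥ [] [] [] = refl
⟪⟫-distribˡ-+ᵥ (y ∷ c) (y′ ∷ c′) (x ∷ a) rewrite ⟪⟫-distribˡ-+ᵥ c c′ a | *-distribʳ-+ x y y′ =
  interchange (y * x) (y′ * x) ⟪ c , a ⟫ ⟪ c′ , a ⟫

⟪⟫-replicate : ∀ k (a : Vec ℕ n) → ⟪ replicate n k , a ⟫ ≡ k * sum a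
⟪⟫-replicate k [] = sym (*-zeroʳ k)
⟪⟫-replicate k (x ∷ a) rewrite ⟪⟫-replicate k a = sym (*-distribˡ-+ k x (sum a))

⟪⟫-map-* : ∀ k (c a : Vec ℕ n) → ⟪ map (k *_) c , a ⟫ ≡ k * ⟪ c , a ⟫
⟪⟫-map-* k [] [] = sym (*-zeroʳ k)
⟪⟫-map-* k (y ∷ c) (x ∷ a) rewrite ⟪⟫-map-* k c a | *-assoc k y x = sym (*-distribˡ-+ k (y * x) ⟪ c , a ⟫)

⟪⟫-once : ∀ i (a : Vec ℕ n) → ⟪ once (just i) , a ⟫ ≡ lookup a i
⟪⟫-once zero (x ∷ a) rewrite ⟪⟫-zeroˡ a = trans (+-identityʳ (x + 0)) (+-identityʳ x)
⟪⟫-once (suc i) (x ∷ a) = ⟪⟫-once i a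

indicator : Subset n → Vec ℕ n
indicator = map (λ s → select s 1)

mass≡⟪indicator⟫ : ∀ (p : Subset n) a → mass p a ≡ ⟪ indicator p , a ⟫
mass≡⟪indicator⟫ [] [] = refl
mass≡⟪indicator⟫ (true ∷ p) (x ∷ a) = cong₂ _+_ (sym (+-identityʳ x)) (mass≡⟪indicator⟫ p a)
mass≡⟪indicator⟫ (false ∷ p) (x ∷ a) = mass≡⟪indicator⟫ p a

⟪⟫-foldr : ∀ (cs : List (Vec ℕ n)) a → ⟪ foldr _+ᵥ_ 0ᵥ cs , a ⟫ ≡ ℕₗ.sum (List.map ⟪_, a ⟫ cs)
⟪⟫-foldr [] a = ⟪⟫-zeroˡ a
⟪⟫-foldr (c ∷ cs) a = trans (⟪⟫-distribˡ-+ᵥ c _ a) (cong (⟪ c , a ⟫ +_) (⟪⟫-foldr cs a))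

-- Refuting systems of mass constraints by branch and bound

data Constraint (n : ℕ) : Set where
  atLeast : ℕ → Subset n → Constraint n
  atMost : Subset n → ℕ → Constraint n

_⊨_ : Vec ℕ n → Constraint n → Set
a ⊨ atLeast c p = c ≤ mass p a
a ⊨ atMost p c = mass p a ≤ c

residual : ℕ → Constraint (suc n) → Maybe (Constraint n)
residual x (atLeast c (s ∷ p)) = just (atLeast (c ∸ select s x) p)
residual x (atMost (s ∷ p) c) = if select s x ≤ᵇ c then just (atMost p (c ∸ select s x)) else nothing

residuals : ℕ → List (Constraint (suc n)) → Maybe (List (Constraint n))
residuals x [] = just []
residuals x (c ∷ cs) = Maybe.zipWith _∷_ (residual x c) (residuals x cs)

hopeless : ℕ → ℕ → Constraint n → Bool
hopeless B t (atLeast c p) = (∣ p ∣ * B <ᵇ c) ∨ (t <ᵇ c)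
hopeless B t (atMost _ _) = false

mutual
  refutes : (n B t : ℕ) → List (Constraint n) → Bool
  refutes zero B t cs = any (hopeless B t) cs
  refutes (suc n) B t cs = any (hopeless B t) cs ∨ all (excluded n B t cs) (upTo (suc B))

  excluded : (n B t : ℕ) → List (Constraint (suc n)) → ℕ → Bool
  excluded n B t cs x = (x ≡ᵇ 1) ∨ (t <ᵇ x) ∨ maybe (refutes n B (t ∸ x)) true (residuals x cs)

residual-sound : ∀ x c {a : Vec ℕ n} → (x ∷ a) ⊨ c → ∃ λ c′ → residual x c ≡ just c′ × a ⊨ c′
residual-sound x (atLeast c (s ∷ p)) h = _ , refl , m≤n+o⇒m∸n≤o c _ h
residual-sound x (atMost (s ∷ p) c) {a} h with select s x ≤ᵇ c in fits
... | true = _ , refl , m+n≤o⇒m≤o∸n (mass p a) (≤-trans (≤-reflexive (+-comm (mass p a) _)) h)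
... | false = ⊥-elim (subst T fits (≤⇒≤ᵇ (m+n≤o⇒m≤o (select s x) h)))

residuals-sound : ∀ x cs {a : Vec ℕ n} → Allₗ.All ((x ∷ a) ⊨_) cs →
  ∃ λ cs′ → residuals x cs ≡ just cs′ × Allₗ.All (a ⊨_) cs′
residuals-sound x [] [] = [] , refl , []
residuals-sound x (c ∷ cs) (h ∷ hs) with residual-sound x c h | residuals-sound x cs hs
... | c′ , eq , h′ | cs′ , eqs , hs′ rewrite eq | eqs = c′ ∷ cs′ , refl , h′ ∷ hs′

hopeless-sound : ∀ {B t} c {a : Vec ℕ n} → T (hopeless B t c) → All (_≤ B) a → sum a ≤ t → ¬ a ⊨ c
hopeless-sound (atLeast c p) {a} h a≤B Σa≤t c≤mass with Equivalence.to T-∨ h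
... | inj₁ cap<c = <⇒≱ (<ᵇ⇒< _ _ cap<c) (≤-trans c≤mass (mass≤∣p∣*B p a≤B))
... | inj₂ t<c = <⇒≱ (<ᵇ⇒< _ _ t<c) (≤-trans c≤mass (≤-trans (mass≤sum p a) Σa≤t))

any-hopeless-sound : ∀ {B t} cs {a : Vec ℕ n} → T (any (hopeless B t) cs) →
  All (_≤ B) a → sum a ≤ t → ¬ Allₗ.All (a ⊨_) cs
any-hopeless-sound cs h a≤B Σa≤t hs =
  let i = any⁻ _ cs h
      sat , hope = Allₗ.lookupAny hs i
  in hopeless-sound (Any.lookup i) hope a≤B Σa≤t sat

mutual
  refutes-sound : ∀ n {B t} cs → T (refutes n B t cs) → ∀ (a : Vec ℕ n) →
    All (_≤ B) a → All (_≢ 1) a → sum a ≤ t → ¬ Allₗ.All (a ⊨_) cs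
  refutes-sound zero cs h a a≤B _ Σa≤t = any-hopeless-sound cs h a≤B Σa≤t
  refutes-sound (suc n) {B} {t} cs h (x ∷ a) (x≤B ∷ a≤B) (x≢1 ∷ a≢1) Σa≤t with Equivalence.to T-∨ h
  ... | inj₁ some-hopeless = any-hopeless-sound cs some-hopeless (x≤B ∷ a≤B) Σa≤t
  ... | inj₂ all-excluded = excluded-sound n cs x
          (Allₗ.lookup (all⁺ (excluded n B t cs) _ all-excluded) (∈-upTo⁺ (s≤s x≤B))) a a≤B x≢1 a≢1 Σa≤t

  excluded-sound : ∀ n {B t} cs x → T (excluded n B t cs x) → ∀ (a : Vec ℕ n) →
    All (_≤ B) a → x ≢ 1 → All (_≢ 1) a → x + sum a ≤ t → ¬ Allₗ.All ((x ∷ a) ⊨_) cs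
  excluded-sound n {B} {t} cs x h a a≤B x≢1 a≢1 Σ≤t hs with Equivalence.to T-∨ h
  ... | inj₁ x≡1 = x≢1 (≡ᵇ⇒≡ x 1 x≡1)
  ... | inj₂ h′ with Equivalence.to T-∨ h′
  ...   | inj₁ t<x = <⇒≱ (<ᵇ⇒< t x t<x) (≤-trans (m≤m+n x (sum a)) Σ≤t)
  ...   | inj₂ subsearch with residuals-sound x cs hs
  ...     | cs′ , eq , hs′ rewrite eq =
    refutes-sound n cs′ subsearch a a≤B a≢1 (subst (_≤ t ∸ x) (m+n∸m≡n x (sum a)) (∸-monoˡ-≤ x Σ≤t)) hs′

-- The field F₃ and the projective plane PG(2,3)

1₃ 2₃ : F3
1₃ = # 1
2₃ = # 2

infixl 6 _⊖_ _⊖ᵥ_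
infix 7 _·_

_⊖_ : F3 → F3 → F3
a ⊖ b = (toℕ a + 2 * toℕ b) mod 3

mismatch : F3 → F3 → ℕ
mismatch x y with x Fin.≟ y
... | yes _ = 0
... | no _ = 1

-- Facts about F₃ and PG(2,3) are proved by evaluating their decision procedures. Those about
-- vectors are stated for vec3 a b c, which makes them apply to every u : Vec3 by conversion.

*₃-distribʳ-⊖ : ∀ a b c → (a ⊖ b) *₃ c ≡ a *₃ c ⊖ b *₃ c
*₃-distribʳ-⊖ = toWitness {a? = all? λ a → all? λ b → all? λ c →
  (a ⊖ b) *₃ c Fin.≟ a *₃ c ⊖ b *₃ c} _

+₃-⊖-interchange : ∀ a a′ b b′ → (a ⊖ a′) +₃ (b ⊖ b′) ≡ (a +₃ b) ⊖ (a′ +₃ b′)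
+₃-⊖-interchange = toWitness {a? = all? λ a → all? λ a′ → all? λ b → all? λ b′ →
  (a ⊖ a′) +₃ (b ⊖ b′) Fin.≟ (a +₃ b) ⊖ (a′ +₃ b′)} _

⊖-identityʳ : ∀ a → a ⊖ 0₃ ≡ a
⊖-identityʳ = toWitness {a? = all? λ a → a ⊖ 0₃ Fin.≟ a} _

⊖≡0⇒≡ : ∀ a b → a ⊖ b ≡ 0₃ → a ≡ b
⊖≡0⇒≡ = toWitness {a? = all? λ a → all? λ b → (a ⊖ b Fin.≟ 0₃) →-dec (a Fin.≟ b)} _

mismatch-⊖ : ∀ x y → mismatch x y ≡ mismatch (x ⊖ y) 0₃
mismatch-⊖ = toWitness {a? = all? λ x → all? λ y → mismatch x y ℕ.≟ mismatch (x ⊖ y) 0₃} _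

Vec3 : Set
Vec3 = Fin 3 → F3

vec3 : F3 → F3 → F3 → Vec3
vec3 a b c zero = a
vec3 a b c (suc zero) = b
vec3 a b c (suc (suc zero)) = c

origin : Vec3
origin _ = 0₃

_·_ : (Fin k → F3) → (Fin k → F3) → F3
u · v = sum₃ (λ i → u i *₃ v i)

_⊖ᵥ_ : (Fin k → F3) → (Fin k → F3) → Fin k → F3
(u ⊖ᵥ v) i = u i ⊖ v i

·-distribʳ-⊖ᵥ : ∀ (u u′ v : Fin k → F3) → (u ⊖ᵥ u′) · v ≡ u · v ⊖ u′ · v
·-distribʳ-⊖ᵥ {zero} u u′ v = refl
·-distribʳ-⊖ᵥ {suc k} u u′ v = begin
  ((u zero ⊖ u′ zero) *₃ v zero) +₃ (((u ⊖ᵥ u′) ∘ suc) · (v ∘ suc))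
    ≡⟨ cong₂ _+₃_ (*₃-distribʳ-⊖ (u zero) (u′ zero) (v zero))
                  (·-distribʳ-⊖ᵥ (u ∘ suc) (u′ ∘ suc) (v ∘ suc)) ⟩
  (u zero *₃ v zero ⊖ u′ zero *₃ v zero) +₃ ((u ∘ suc) · (v ∘ suc) ⊖ (u′ ∘ suc) · (v ∘ suc))
    ≡⟨ +₃-⊖-interchange (u zero *₃ v zero) (u′ zero *₃ v zero)
                         ((u ∘ suc) · (v ∘ suc)) ((u′ ∘ suc) · (v ∘ suc)) ⟩
  u · v ⊖ u′ · v ∎
  where open ≡-Reasoning

·-congˡ : ∀ {u u′ : Fin k → F3} → (∀ i → u i ≡ u′ i) → ∀ v → u · v ≡ u′ · v
·-congˡ {zero} u≗u′ v = refl
·-congˡ {suc k} u≗u′ v = cong₂ _+₃_ (cong (_*₃ v zero) (u≗u′ zero)) (·-congˡ (u≗u′ ∘ suc) (v ∘ suc))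

·-congʳ : ∀ (u : Fin k → F3) {v v′} → (∀ i → v i ≡ v′ i) → u · v ≡ u · v′
·-congʳ {zero} u v≗v′ = refl
·-congʳ {suc k} u v≗v′ = cong₂ _+₃_ (cong (u zero *₃_) (v≗v′ zero)) (·-congʳ (u ∘ suc) (v≗v′ ∘ suc))

Point : Set
Point = Fin 13

-- Points are numbered by their representatives with first nonzero coordinate 1, in lexicographic order.
rep : Point → Vec3
rep = lookup
  ( vec3 0₃ 0₃ 1₃ ∷ vec3 0₃ 1₃ 0₃ ∷ vec3 0₃ 1₃ 1₃ ∷ vec3 0₃ 1₃ 2₃
  ∷ vec3 1₃ 0₃ 0₃ ∷ vec3 1₃ 0₃ 1₃ ∷ vec3 1₃ 0₃ 2₃ ∷ vec3 1₃ 1₃ 0₃ ∷ vec3 1₃ 1₃ 1₃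
  ∷ vec3 1₃ 1₃ 2₃ ∷ vec3 1₃ 2₃ 0₃ ∷ vec3 1₃ 2₃ 1₃ ∷ vec3 1₃ 2₃ 2₃ ∷ [])

pointOf : Vec3 → Maybe Point
pointOf u = lookup (lookup (lookup table (u (# 0))) (u (# 1))) (u (# 2))
  where
  table : Vec (Vec (Vec (Maybe Point) 3) 3) 3
  table =
    ( (nothing ∷ just (# 0) ∷ just (# 0) ∷ [])
    ∷ (just (# 1) ∷ just (# 2) ∷ just (# 3) ∷ [])
    ∷ (just (# 1) ∷ just (# 3) ∷ just (# 2) ∷ []) ∷ [])
    ∷ ( (just (# 4) ∷ just (# 5) ∷ just (# 6) ∷ [])
    ∷ (just (# 7) ∷ just (# 8) ∷ just (# 9) ∷ [])
    ∷ (just (# 10) ∷ just (# 11) ∷ just (# 12) ∷ []) ∷ [])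
    ∷ ( (just (# 4) ∷ just (# 6) ∷ just (# 5) ∷ [])
    ∷ (just (# 10) ∷ just (# 12) ∷ just (# 11) ∷ [])
    ∷ (just (# 7) ∷ just (# 9) ∷ just (# 8) ∷ []) ∷ []) ∷ []

_≟ₚ_ : (x y : Maybe Point) → Dec (x ≡ y)
_≟ₚ_ = Maybe.≡-dec Fin._≟_

-- The points where the linear form δ does not vanish: the complement of the line δ⊥ (empty for δ = 0).
-- Lines are indexed by points through this duality: line L is rep L ⊥.
offLine : Vec3 → Subset 13
offLine δ = tabulate λ Q → isNo (δ · rep Q Fin.≟ 0₃)

offLineMass : Vec ℕ 13 → Point → ℕ
offLineMass a L = mass (offLine (rep L)) a

EveryLineMisses : ℕ → Vec ℕ 13 → Set
EveryLineMisses d a = ∀ L → d ≤ offLineMass a L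

offLine-cong : ∀ {δ δ′ : Vec3} → (∀ i → δ i ≡ δ′ i) → offLine δ ≡ offLine δ′
offLine-cong δ≗δ′ = Vecₚ.tabulate-cong λ Q → cong (λ x → isNo (x Fin.≟ 0₃)) (·-congˡ δ≗δ′ (rep Q))

pointOf-rep : ∀ P → pointOf (rep P) ≡ just P
pointOf-rep = toWitness {a? = all? λ P → pointOf (rep P) ≟ₚ just P} _

rep-nonzero : ∀ L → ¬ (∀ i → rep L i ≡ 0₃)
rep-nonzero = toWitness {a? = all? λ L → ¬? (all? λ i → rep L i Fin.≟ 0₃)} _

coordinatewise : ∀ {u v : Vec3} → u (# 0) ≡ v (# 0) → u (# 1) ≡ v (# 1) → u (# 2) ≡ v (# 2) → ∀ i → u i ≡ v i
coordinatewise e₀ e₁ e₂ zero = e₀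
coordinatewise e₀ e₁ e₂ (suc zero) = e₁
coordinatewise e₀ e₁ e₂ (suc (suc zero)) = e₂

pointOf-nothing : ∀ u → pointOf u ≡ nothing → ∀ i → u i ≡ 0₃
pointOf-nothing u u↦nothing =
  let e₀ , e₁ , e₂ = on-triples (u (# 0)) (u (# 1)) (u (# 2)) u↦nothing in coordinatewise e₀ e₁ e₂
  where
  on-triples : ∀ a b c → pointOf (vec3 a b c) ≡ nothing → a ≡ 0₃ × b ≡ 0₃ × c ≡ 0₃
  on-triples = toWitness {a? = all? λ a → all? λ b → all? λ c →
    (pointOf (vec3 a b c) ≟ₚ nothing) →-dec ((a Fin.≟ 0₃) ×-dec (b Fin.≟ 0₃) ×-dec (c Fin.≟ 0₃))} _

offLine-point : ∀ δ {L} → pointOf δ ≡ just L → offLine δ ≡ offLine (rep L)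
offLine-point δ = on-triples (δ (# 0)) (δ (# 1)) (δ (# 2)) _
  where
  on-triples : ∀ a b c L → pointOf (vec3 a b c) ≡ just L → offLine (vec3 a b c) ≡ offLine (rep L)
  on-triples = toWitness {a? = all? λ a → all? λ b → all? λ c → all? λ L →
    (pointOf (vec3 a b c) ≟ₚ just L) →-dec Vecₚ.≡-dec Bool._≟_ (offLine (vec3 a b c)) (offLine (rep L))} _

mismatch-· : ∀ δ v → mismatch (δ · v) 0₃ ≡ mass (offLine δ) (once (pointOf v))
mismatch-· δ v = on-triples (δ (# 0)) (δ (# 1)) (δ (# 2)) (v (# 0)) (v (# 1)) (v (# 2))
  where
  on-triples : ∀ a b c x y z →
    mismatch (vec3 a b c · vec3 x y z) 0₃ ≡ mass (offLine (vec3 a b c)) (once (pointOf (vec3 x y z)))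
  on-triples = toWitness {a? = all? λ a → all? λ b → all? λ c → all? λ x → all? λ y → all? λ z →
    mismatch (vec3 a b c · vec3 x y z) 0₃ ℕ.≟ mass (offLine (vec3 a b c)) (once (pointOf (vec3 x y z)))} _

-- Opaque so that the witness m, found by search, is never unfolded at symbolic coordinates.
opaque
  separatingForm : ∀ u v {P} → pointOf u ≡ just P → pointOf v ≢ just P → ∃ λ m → m · v ≡ 0₃ × m · u ≢ 0₃
  separatingForm u v u↦P v↦̸P =
    on-triples (u (# 0)) (u (# 1)) (u (# 2)) (v (# 0)) (v (# 1)) (v (# 2))
      (subst (_≢ nothing) (sym u↦P) λ ()) (λ v↦u → v↦̸P (trans v↦u u↦P))
    where
    search : ∀ a b c x y z → pointOf (vec3 a b c) ≢ nothing → pointOf (vec3 x y z) ≢ pointOf (vec3 a b c) →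
      ∃ λ m₀ → ∃ λ m₁ → ∃ λ m₂ → vec3 m₀ m₁ m₂ · vec3 x y z ≡ 0₃ × vec3 m₀ m₁ m₂ · vec3 a b c ≢ 0₃
    search = toWitness {a? = all? λ a → all? λ b → all? λ c → all? λ x → all? λ y → all? λ z →
      ¬? (pointOf (vec3 a b c) ≟ₚ nothing) →-dec ¬? (pointOf (vec3 x y z) ≟ₚ pointOf (vec3 a b c)) →-dec
      any? λ m₀ → any? λ m₁ → any? λ m₂ →
        (vec3 m₀ m₁ m₂ · vec3 x y z Fin.≟ 0₃) ×-dec ¬? (vec3 m₀ m₁ m₂ · vec3 a b c Fin.≟ 0₃)} _
    on-triples : ∀ a b c x y z → pointOf (vec3 a b c) ≢ nothing → pointOf (vec3 x y z) ≢ pointOf (vec3 a b c) →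
      ∃ λ m → m · vec3 x y z ≡ 0₃ × m · vec3 a b c ≢ 0₃
    on-triples a b c x y z u≢0 v≢u =
      let m₀ , m₁ , m₂ , separates = search a b c x y z u≢0 v≢u in vec3 m₀ m₁ m₂ , separates

linesThrough : Point → List Point
linesThrough P = filter (λ L → rep L · rep P Fin.≟ 0₃) (allFin 13)

length-linesThrough : ∀ P → length (linesThrough P) ≡ 4
length-linesThrough = toWitness {a? = all? λ P → length (linesThrough P) ℕ.≟ 4} _

∣∁offLine∣≡4 : ∀ L → ∣ ∁ (offLine (rep L)) ∣ ≡ 4
∣∁offLine∣≡4 = toWitness {a? = all? λ L → ∣ ∁ (offLine (rep L)) ∣ ℕ.≟ 4} _

-- The four lines through P cover every other point exactly once, so each point Q ≢ P lies
-- off exactly three of them, and P off none.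
linesThrough-cover : ∀ P →
  foldr _+ᵥ_ 0ᵥ (List.map (indicator ∘ offLine ∘ rep) (linesThrough P)) +ᵥ map (3 *_) (once (just P))
    ≡ replicate 13 3
linesThrough-cover = toWitness {a? = all? λ P → Vecₚ.≡-dec ℕ._≟_
  (foldr _+ᵥ_ 0ᵥ (List.map (indicator ∘ offLine ∘ rep) (linesThrough P)) +ᵥ map (3 *_) (once (just P)))
  (replicate 13 3)} _

-- Codes as multisets of points

column : Matrix k n → Fin n → Fin k → F3
column G j i = G i j

points : Matrix 3 n → Vec ℕ 13
points G = histogram (pointOf ∘ column G)

hdist-cons : ∀ (x y : Fin (suc n) → F3) → hdist x y ≡ mismatch (x zero) (y zero) + hdist (x ∘ suc) (y ∘ suc)
hdist-cons x y with x zero Fin.≟ y zero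
... | yes _ = refl
... | no _ = refl

hdist≡0 : ∀ {x y : Fin n → F3} → (∀ j → x j ≡ y j) → hdist x y ≡ 0
hdist≡0 {zero} x≗y = refl
hdist≡0 {suc n} {x} {y} x≗y with x zero Fin.≟ y zero
... | yes _ = hdist≡0 (x≗y ∘ suc)
... | no x₀≢y₀ = contradiction (x≗y zero) x₀≢y₀

hdist-encode : ∀ (G : Matrix 3 n) m m′ → hdist (encode G m) (encode G m′) ≡ mass (offLine (m ⊖ᵥ m′)) (points G)
hdist-encode {zero} G m m′ = sym (mass-0ᵥ (offLine (m ⊖ᵥ m′)))
hdist-encode {suc n} G m m′ = begin
  hdist (encode G m) (encode G m′)
    ≡⟨ hdist-cons (encode G m) (encode G m′) ⟩
  mismatch (m · c) (m′ · c) + hdist (encode G′ m) (encode G′ m′)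
    ≡⟨ cong₂ _+_ (trans (mismatch-⊖ (m · c) (m′ · c)) (cong (λ x → mismatch x 0₃) (sym (·-distribʳ-⊖ᵥ m m′ c))))
                 (hdist-encode G′ m m′) ⟩
  mismatch ((m ⊖ᵥ m′) · c) 0₃ + mass off (points G′)
    ≡⟨ cong (_+ mass off (points G′)) (mismatch-· (m ⊖ᵥ m′) c) ⟩
  mass off (once (pointOf c)) + mass off (points G′)
    ≡⟨ sym (mass-+ᵥ off (once (pointOf c)) (points G′)) ⟩
  mass off (points G) ∎
  where
  open ≡-Reasoning
  c = column G zero
  G′ : Matrix 3 n
  G′ i j = G i (suc j)
  off = offLine (m ⊖ᵥ m′)

minDist⇒everyLineMisses : ∀ {d} (G : Matrix 3 n) → MinDistAtLeast G d → EveryLineMisses d (points G)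
minDist⇒everyLineMisses {d = d} G minDist L = subst (d ≤_) distance (minDist (rep L) origin (rep-nonzero L))
  where
  distance : hdist (encode G (rep L)) (encode G origin) ≡ offLineMass (points G) L
  distance = trans (hdist-encode G (rep L) origin) (cong (λ p → mass p (points G)) (offLine-cong (⊖-identityʳ ∘ rep L)))

everyLineMisses⇒minDist : ∀ {d} (G : Matrix 3 n) → EveryLineMisses d (points G) → MinDistAtLeast G d
everyLineMisses⇒minDist {d = d} G misses m m′ m≢m′ = byPoint (pointOf (m ⊖ᵥ m′)) refl
  where
  byPoint : ∀ x → pointOf (m ⊖ᵥ m′) ≡ x → d ≤ hdist (encode G m) (encode G m′)
  byPoint (just L) δ↦L = subst (d ≤_) (sym distance) (misses L)
    where
    distance : hdist (encode G m) (encode G m′) ≡ offLineMass (points G) L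
    distance = trans (hdist-encode G m m′) (cong (λ p → mass p (points G)) (offLine-point (m ⊖ᵥ m′) δ↦L))
  byPoint nothing δ↦nothing =
    contradiction (λ i → ⊖≡0⇒≡ (m i) (m′ i) (pointOf-nothing (m ⊖ᵥ m′) δ↦nothing i)) m≢m′

minDist⇒linIndepRows : ∀ {d} (G : Matrix 3 n) → 1 ≤ d → MinDistAtLeast G d → LinIndepRows G
minDist⇒linIndepRows {d = d} G 1≤d minDist m mG≡0 i with m i Fin.≟ 0₃
... | yes mᵢ≡0 = mᵢ≡0
... | no mᵢ≢0 = contradiction (≤-trans 1≤d d≤0) λ ()
  where
  d≤0 : d ≤ 0
  d≤0 = subst (d ≤_) (hdist≡0 mG≡0) (minDist m origin (λ m≡0 → mᵢ≢0 (m≡0 i)))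

locality-1⇒constant⊎determined : ∀ (G : Matrix k n) → HasLocality G 1 → ∀ i →
  (∀ m m′ → encode G m i ≡ encode G m′ i) ⊎
  ∃ λ j → j ≢ i × (∀ m m′ → encode G m j ≡ encode G m′ j → encode G m i ≡ encode G m′ i)
locality-1⇒constant⊎determined G loc i with loc i
... | S , i∉S , ∣S∣≤1 , determines with nonempty? S
...   | no empty = inj₁ λ m m′ → determines m m′ λ j j∈S → ⊥-elim (empty (j , j∈S))
...   | yes (j , j∈S) = inj₂ (j , (λ { refl → i∉S j∈S }) , λ m m′ agree → determines m m′ λ j′ j′∈S →
          subst (λ x → encode G m x ≡ encode G m′ x) (sym (only j′∈S)) agree)
  where
  only : ∀ {j′} → j′ ∈ S → j′ ≡ j
  only {j′} j′∈S with j′ Fin.≟ j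
  ... | yes j′≡j = j′≡j
  ... | no j′≢j = contradiction ∣S∣≤1 (<⇒≱ 1<∣S∣)
    where
    1<∣S∣ : 1 < ∣ S ∣
    1<∣S∣ = ≤-<-trans (≤-<-trans z≤n (x∈p⇒∣p-x∣<∣p∣ (x∈p∧x≢y⇒x∈p-y j′∈S j′≢j))) (x∈p⇒∣p-x∣<∣p∣ j∈S)

locality⇒twinPoints : ∀ (G : Matrix 3 n) → HasLocality G 1 → ∀ i {P} → pointOf (column G i) ≡ just P →
  ∃ λ j → j ≢ i × pointOf (column G j) ≡ just P
locality⇒twinPoints G loc i {P} u↦P = [ constant⇒⊥ , determined⇒twin ]′ (locality-1⇒constant⊎determined G loc i)
  where
  Twin = ∃ λ j → j ≢ i × pointOf (column G j) ≡ just P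
  constant⇒⊥ : (∀ m m′ → encode G m i ≡ encode G m′ i) → Twin
  constant⇒⊥ constant =
    let m , _ , mu≢0 = separatingForm (column G i) origin u↦P (λ ()) in contradiction (constant m origin) mu≢0
  determined⇒twin : (∃ λ j → j ≢ i × (∀ m m′ → encode G m j ≡ encode G m′ j → encode G m i ≡ encode G m′ i)) → Twin
  determined⇒twin (j , j≢i , determined) = samePoint (pointOf (column G j) ≟ₚ just P)
    where
    samePoint : Dec (pointOf (column G j) ≡ just P) → Twin
    samePoint (yes v↦P) = j , j≢i , v↦P
    samePoint (no v↦̸P) =
      let m , mv≡0 , mu≢0 = separatingForm (column G i) (column G j) u↦P v↦̸P
      in contradiction (determined m origin mv≡0) mu≢0

locality⇒noSingletons : ∀ (G : Matrix 3 n) → HasLocality G 1 → All (_≢ 1) (points G)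
locality⇒noSingletons G loc = histogram-no-singletons (pointOf ∘ column G) (locality⇒twinPoints G loc)

twinColumns⇒locality : ∀ (G : Matrix k n) → (∀ i → ∃ λ j → j ≢ i × (∀ r → G r j ≡ G r i)) → HasLocality G 1
twinColumns⇒locality G twin i =
  let j , j≢i , same = twin i in
  ⁅ j ⁆ , (λ i∈⁅j⁆ → j≢i (sym (x∈⁅y⁆⇒x≡y j i∈⁅j⁆))) , ≤-reflexive (∣⁅x⁆∣≡1 j) ,
  λ m m′ agree → begin
    m · column G i  ≡⟨ ·-congʳ m (sym ∘ same) ⟩
    m · column G j  ≡⟨ agree j (x∈⁅x⁆ j) ⟩
    m′ · column G j ≡⟨ ·-congʳ m′ same ⟩
    m′ · column G i ∎
  where open ≡-Reasoning

realize : (a : Vec ℕ 13) → Matrix 3 (sum a)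
realize a i j = rep (block a j) i

points-realize : ∀ a → points (realize a) ≡ a
points-realize a = trans (histogram-cong (pointOf-rep ∘ block a)) (histogram-block a)

multiset⇒LRC : ∀ {d} (a : Vec ℕ 13) → 1 ≤ d → All (_≢ 1) a → EveryLineMisses d a → LRCExists (sum a) 3 d 1
multiset⇒LRC {d} a 1≤d noSingletons misses =
  realize a , minDist⇒linIndepRows (realize a) 1≤d minDist , minDist , twinColumns⇒locality (realize a) twins
  where
  minDist : MinDistAtLeast (realize a) d
  minDist = everyLineMisses⇒minDist (realize a) (subst (EveryLineMisses d) (sym (points-realize a)) misses)
  twins : ∀ i → ∃ λ j → j ≢ i × (∀ r → realize a r j ≡ realize a r i)
  twins i = let j , j≢i , same = block-twin noSingletons i in j , j≢i , λ r → cong (λ P → rep P r) same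

-- The Griesmer bound

⌈_/3⌉ : ℕ → ℕ
⌈ 0 /3⌉ = 0
⌈ 1 /3⌉ = 1
⌈ 2 /3⌉ = 1
⌈ suc (suc (suc n)) /3⌉ = suc ⌈ n /3⌉

griesmer : ℕ → ℕ
griesmer d = d + ⌈ d /3⌉ + ⌈ ⌈ d /3⌉ /3⌉

3*⌈n/3⌉≤n+2 : ∀ n → 3 * ⌈ n /3⌉ ≤ n + 2
3*⌈n/3⌉≤n+2 0 = z≤n
3*⌈n/3⌉≤n+2 1 = s≤s (s≤s (s≤s z≤n))
3*⌈n/3⌉≤n+2 2 = s≤s (s≤s (s≤s z≤n))
3*⌈n/3⌉≤n+2 (suc (suc (suc n))) = begin
  3 * suc ⌈ n /3⌉   ≡⟨ *-suc 3 ⌈ n /3⌉ ⟩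
  3 + 3 * ⌈ n /3⌉   ≤⟨ +-monoʳ-≤ 3 (3*⌈n/3⌉≤n+2 n) ⟩
  3 + (n + 2)       ∎
  where open ≤-Reasoning

1≤⌈1+n/3⌉ : ∀ n → 1 ≤ ⌈ suc n /3⌉
1≤⌈1+n/3⌉ 0 = s≤s z≤n
1≤⌈1+n/3⌉ 1 = s≤s z≤n
1≤⌈1+n/3⌉ (suc (suc n)) = s≤s z≤n

⌈/3⌉-mono-≤ : ∀ {m n} → m ≤ n → ⌈ m /3⌉ ≤ ⌈ n /3⌉
⌈/3⌉-mono-≤ {0} _ = z≤n
⌈/3⌉-mono-≤ {1} {suc n} _ = 1≤⌈1+n/3⌉ n
⌈/3⌉-mono-≤ {2} {suc n} _ = 1≤⌈1+n/3⌉ n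
⌈/3⌉-mono-≤ {suc (suc (suc m))} (s≤s (s≤s (s≤s m≤n))) = s≤s (⌈/3⌉-mono-≤ m≤n)

griesmer-mono-≤ : ∀ {d e} → d ≤ e → griesmer d ≤ griesmer e
griesmer-mono-≤ d≤e = +-mono-≤ (+-mono-≤ d≤e (⌈/3⌉-mono-≤ d≤e)) (⌈/3⌉-mono-≤ (⌈/3⌉-mono-≤ d≤e))

4w+3x≤3t⇒x+w+⌈w/3⌉≤t : ∀ w x t → 4 * w + 3 * x ≤ 3 * t → x + w + ⌈ w /3⌉ ≤ t
4w+3x≤3t⇒x+w+⌈w/3⌉≤t w x t h = ≤-pred (*-cancelˡ-< 3 _ _ (begin-strict
  3 * (x + w + c)         ≡⟨ expand ⟩
  3 * x + 3 * w + 3 * c   ≤⟨ +-monoʳ-≤ (3 * x + 3 * w) (3*⌈n/3⌉≤n+2 w) ⟩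
  3 * x + 3 * w + (w + 2) ≡⟨ regroup ⟩
  4 * w + 3 * x + 2       ≤⟨ +-monoˡ-≤ 2 h ⟩
  3 * t + 2               <⟨ +-monoʳ-< (3 * t) (n<1+n 2) ⟩
  3 * t + 3               ≡⟨ trans (+-comm (3 * t) 3) (sym (*-suc 3 t)) ⟩
  3 * suc t               ∎))
  where
  open ≤-Reasoning
  c = ⌈ w /3⌉
  expand : 3 * (x + w + c) ≡ 3 * x + 3 * w + 3 * c
  expand = solve 3 (λ x w c → con 3 :* (x :+ w :+ c) := con 3 :* x :+ con 3 :* w :+ con 3 :* c) refl x w c
  regroup : 3 * x + 3 * w + (w + 2) ≡ 4 * w + 3 * x + 2
  regroup = solve 2 (λ x w → con 3 :* x :+ con 3 :* w :+ (w :+ con 2) := con 4 :* w :+ con 3 :* x :+ con 2) refl x w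

4w≤3t⇒w+⌈w/3⌉≤t : ∀ w t → 4 * w ≤ 3 * t → w + ⌈ w /3⌉ ≤ t
4w≤3t⇒w+⌈w/3⌉≤t w t h = 4w+3x≤3t⇒x+w+⌈w/3⌉≤t w 0 t (subst (_≤ 3 * t) (sym (+-identityʳ (4 * w))) h)

griesmer-+18 : ∀ d → griesmer (18 + d) ≡ 26 + griesmer d
griesmer-+18 d = solve 3 (λ d c c′ → con 18 :+ d :+ (con 6 :+ c) :+ (con 2 :+ c′) := con 26 :+ (d :+ c :+ c′))
  refl d ⌈ d /3⌉ ⌈ ⌈ d /3⌉ /3⌉

point-identity : ∀ a P → ℕₗ.sum (List.map (offLineMass a) (linesThrough P)) + 3 * lookup a P ≡ 3 * sum a
point-identity a P = begin
  ℕₗ.sum (List.map (offLineMass a) lines) + 3 * lookup a P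
    ≡⟨ cong₂ _+_ (cong ℕₗ.sum (trans (Listₚ.map-cong (λ L → mass≡⟪indicator⟫ (offLine (rep L)) a) lines)
                                      (Listₚ.map-∘ lines)))
                 (cong (3 *_) (sym (⟪⟫-once P a))) ⟩
  ℕₗ.sum (List.map ⟪_, a ⟫ (List.map offIndicator lines)) + 3 * ⟪ once (just P) , a ⟫
    ≡⟨ cong₂ _+_ (sym (⟪⟫-foldr (List.map offIndicator lines) a)) (sym (⟪⟫-map-* 3 (once (just P)) a)) ⟩
  ⟪ Σoff , a ⟫ + ⟪ map (3 *_) (once (just P)) , a ⟫
    ≡⟨ sym (⟪⟫-distribˡ-+ᵥ Σoff _ a) ⟩
  ⟪ Σoff +ᵥ map (3 *_) (once (just P)) , a ⟫
    ≡⟨ cong ⟪_, a ⟫ (linesThrough-cover P) ⟩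
  ⟪ replicate 13 3 , a ⟫
    ≡⟨ ⟪⟫-replicate 3 a ⟩
  3 * sum a ∎
  where
  open ≡-Reasoning
  lines = linesThrough P
  offIndicator = indicator ∘ offLine ∘ rep
  Σoff = foldr _+ᵥ_ 0ᵥ (List.map offIndicator lines)

length*≤sum-map : ∀ {A : Set} {w} (f : A → ℕ) xs → (∀ x → w ≤ f x) → length xs * w ≤ ℕₗ.sum (List.map f xs)
length*≤sum-map f [] _ = z≤n
length*≤sum-map f (x ∷ xs) w≤f = +-mono-≤ (w≤f x) (length*≤sum-map f xs w≤f)

point-bound : ∀ {w} a → EveryLineMisses w a → ∀ P → 4 * w + 3 * lookup a P ≤ 3 * sum a
point-bound {w} a misses P = begin
  4 * w + 3 * lookup a P
    ≡⟨ cong (λ l → l * w + 3 * lookup a P) (sym (length-linesThrough P)) ⟩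
  length (linesThrough P) * w + 3 * lookup a P
    ≤⟨ +-monoˡ-≤ (3 * lookup a P) (length*≤sum-map (offLineMass a) (linesThrough P) misses) ⟩
  ℕₗ.sum (List.map (offLineMass a) (linesThrough P)) + 3 * lookup a P
    ≡⟨ point-identity a P ⟩
  3 * sum a ∎
  where open ≤-Reasoning

multiplicity-bound : ∀ {d N} a → EveryLineMisses d a → sum a ≤ N → All (_≤ N ∸ (d + ⌈ d /3⌉)) a
multiplicity-bound {d} {N} a misses Σa≤N = lookup⁻ λ P → m+n≤o⇒m≤o∸n (lookup a P) (begin
  lookup a P + (d + ⌈ d /3⌉) ≡⟨ sym (+-assoc (lookup a P) d ⌈ d /3⌉) ⟩
  lookup a P + d + ⌈ d /3⌉   ≤⟨ 4w+3x≤3t⇒x+w+⌈w/3⌉≤t d (lookup a P) N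
                                  (≤-trans (point-bound a misses P) (*-monoʳ-≤ 3 Σa≤N)) ⟩
  N                           ∎)
  where open ≤-Reasoning

o+4[w+c]≤4[o+w]⇒4c≤3o : ∀ o w c → o + 4 * (w + c) ≤ 4 * (o + w) → 4 * c ≤ 3 * o
o+4[w+c]≤4[o+w]⇒4c≤3o o w c h = +-cancelˡ-≤ (o + 4 * w) _ _ (begin
  o + 4 * w + 4 * c  ≡⟨ solve 3 (λ o w c → o :+ con 4 :* w :+ con 4 :* c := o :+ con 4 :* (w :+ c)) refl o w c ⟩
  o + 4 * (w + c)    ≤⟨ h ⟩
  4 * (o + w)        ≡⟨ solve 2 (λ o w → con 4 :* (o :+ w) := o :+ con 4 :* w :+ con 3 :* o) refl o w ⟩
  o + 4 * w + 3 * o  ∎)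
  where open ≤-Reasoning

-- With w the least off-line mass, attained on L₀, every point has multiplicity at most n − w − ⌈w/3⌉;
-- summing over the four points of L₀ bounds the mass o = n − w on L₀ by 4c ≤ 3o, c = ⌈w/3⌉.
griesmer-minimalLine : ∀ a L₀ → EveryLineMisses (offLineMass a L₀) a → griesmer (offLineMass a L₀) ≤ sum a
griesmer-minimalLine a L₀ minimal = begin
  w + c + ⌈ c /3⌉   ≡⟨ +-assoc w c ⌈ c /3⌉ ⟩
  w + (c + ⌈ c /3⌉) ≤⟨ +-monoʳ-≤ w (4w≤3t⇒w+⌈w/3⌉≤t c o (o+4[w+c]≤4[o+w]⇒4c≤3o o w c on-line)) ⟩
  w + o             ≡⟨ +-comm w o ⟩
  o + w             ≡⟨ o+w≡Σa ⟩
  sum a             ∎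
  where
  open ≤-Reasoning
  w = offLineMass a L₀
  c = ⌈ w /3⌉
  o = mass (∁ (offLine (rep L₀))) a
  o+w≡Σa : o + w ≡ sum a
  o+w≡Σa = mass-∁ (offLine (rep L₀)) a
  light-point : ∀ P → lookup a P + (w + c) ≤ o + w
  light-point P = begin
    lookup a P + (w + c) ≡⟨ sym (+-assoc (lookup a P) w c) ⟩
    lookup a P + w + c   ≤⟨ 4w+3x≤3t⇒x+w+⌈w/3⌉≤t w (lookup a P) (sum a) (point-bound a minimal P) ⟩
    sum a                ≡⟨ sym o+w≡Σa ⟩
    o + w                ∎
  on-line : o + 4 * (w + c) ≤ 4 * (o + w)
  on-line = subst (λ k → o + k * (w + c) ≤ k * (o + w)) (∣∁offLine∣≡4 L₀)
    (mass-bound (∁ (offLine (rep L₀))) {a} (lookup⁻ {P = λ x → x + (w + c) ≤ o + w} light-point))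

minimum : ∀ (f : Fin (suc n) → ℕ) → ∃ λ i → ∀ j → f i ≤ f j
minimum f = argmin f zero (allFin _) , λ j → Allₗ.lookup (f[argmin]≤f[xs] {f = f} zero (allFin _)) (∈-allFin j)

griesmer-bound : ∀ {d} a → EveryLineMisses d a → griesmer d ≤ sum a
griesmer-bound a misses =
  let L₀ , minimal = minimum (offLineMass a) in ≤-trans (griesmer-mono-≤ (misses L₀)) (griesmer-minimalLine a L₀ minimal)

code⇒griesmer : ∀ {d} → CodeExists n 3 d → griesmer d ≤ n
code⇒griesmer (G , _ , minDist) =
  ≤-trans (griesmer-bound (points G) (minDist⇒everyLineMisses G minDist)) (sum-histogram≤ (pointOf ∘ column G))

-- Lower bounds for codes with locality 1

lineConstraints : ℕ → ℕ → List (Constraint 13)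
lineConstraints d N =
  List.tabulate (λ L → atLeast d (offLine (rep L))) ++ List.tabulate (λ L → atMost (∁ (offLine (rep L))) (N ∸ d))

onLineMass≤ : ∀ {d N} a L → d ≤ offLineMass a L → sum a ≤ N → mass (∁ (offLine (rep L))) a ≤ N ∸ d
onLineMass≤ a L d≤off Σa≤N = m+n≤o⇒m≤o∸n _
  (≤-trans (+-monoʳ-≤ _ d≤off) (≤-trans (≤-reflexive (mass-∁ (offLine (rep L)) a)) Σa≤N))

no-LRC-by-search : ∀ d N → T (refutes 13 (N ∸ (d + ⌈ d /3⌉)) N (lineConstraints d N)) →
  ∀ n → n ≤ N → ¬ LRCExists n 3 d 1
no-LRC-by-search d N refuted n n≤N (G , _ , minDist , loc) =
  refutes-sound 13 (lineConstraints d N) refuted a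
    (multiplicity-bound a misses Σa≤N) (locality⇒noSingletons G loc) Σa≤N
    (++⁺ (tabulate⁺ {f = λ L → atLeast d (offLine (rep L))} misses)
         (tabulate⁺ {f = λ L → atMost (∁ (offLine (rep L))) (N ∸ d)} λ L → onLineMass≤ a L (misses L) Σa≤N))
  where
  a = points G
  misses : EveryLineMisses d a
  misses = minDist⇒everyLineMisses G minDist
  Σa≤N : sum a ≤ N
  Σa≤N = ≤-trans (sum-histogram≤ (pointOf ∘ column G)) n≤N

lrc⇒code : ∀ {n k d r} → LRCExists n k d r → CodeExists n k d
lrc⇒code (G , indep , minDist , _) = G , indep , minDist

shorter-refuted-by-search : ∀ {d} N → {T (refutes 13 (N ∸ (d + ⌈ d /3⌉)) N (lineConstraints d N))} →
  ∀ n → n < suc N → ¬ LRCExists n 3 d 1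
shorter-refuted-by-search {d} N {refuted} n n<1+N = no-LRC-by-search d N refuted n (≤-pred n<1+N)

shorter-than-griesmer : ∀ {d} n → n < griesmer d → ¬ LRCExists n 3 d 1
shorter-than-griesmer n n<g lrc = <⇒≱ n<g (code⇒griesmer (lrc⇒code lrc))

-- Arcs attaining the bounds

-- A multiset of n points of PG(2,3) met by every line in at most n − d points (an (n, n − d)-multiarc)
-- with no point of multiplicity 1: the point multiset of an [n,3,d]₃ code with locality 1.
record PairedArc (n d : ℕ) : Set where
  field
    multiplicities : Vec ℕ 13
    size : sum multiplicities ≡ n
    noSingletons : All (_≢ 1) multiplicities
    everyLineMisses : EveryLineMisses d multiplicities

arc : ∀ {n d} (a : Vec ℕ 13) → {True (sum a ℕ.≟ n)} → {True (All.all? (λ x → ¬? (x ℕ.≟ 1)) a)} →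
  {True (all? λ L → d ℕ.≤? offLineMass a L)} → PairedArc n d
arc a {size} {noSingletons} {misses} = record
  { multiplicities = a
  ; size = toWitness size
  ; noSingletons = toWitness noSingletons
  ; everyLineMisses = toWitness misses
  }

arc⇒LRC : ∀ {n d} → 1 ≤ d → PairedArc n d → LRCExists n 3 d 1
arc⇒LRC 1≤d A = subst (λ n → LRCExists n 3 _ 1) (PairedArc.size A)
  (multiset⇒LRC (PairedArc.multiplicities A) 1≤d (PairedArc.noSingletons A) (PairedArc.everyLineMisses A))

+≢1 : ∀ {x y} → x ≢ 1 → y ≢ 1 → x + y ≢ 1
+≢1 {zero} _ y≢1 = y≢1
+≢1 {suc zero} x≢1 _ = contradiction refl x≢1
+≢1 {suc (suc x)} _ _ ()

_⊕_ : ∀ {n n′ d d′} → PairedArc n d → PairedArc n′ d′ → PairedArc (n + n′) (d + d′)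
A ⊕ B = record
  { multiplicities = a +ᵥ b
  ; size = trans (sum-+ᵥ a b) (cong₂ _+_ (PairedArc.size A) (PairedArc.size B))
  ; noSingletons = noSingletons-+ᵥ (PairedArc.noSingletons A) (PairedArc.noSingletons B)
  ; everyLineMisses = λ L → subst (_ ≤_) (sym (mass-+ᵥ (offLine (rep L)) a b))
      (+-mono-≤ (PairedArc.everyLineMisses A L) (PairedArc.everyLineMisses B L))
  }
  where
  a = PairedArc.multiplicities A
  b = PairedArc.multiplicities B
  noSingletons-+ᵥ : ∀ {a b : Vec ℕ k} → All (_≢ 1) a → All (_≢ 1) b → All (_≢ 1) (a +ᵥ b)
  noSingletons-+ᵥ [] [] = []
  noSingletons-+ᵥ (x≢1 ∷ a≢1) (y≢1 ∷ b≢1) = +≢1 x≢1 y≢1 ∷ noSingletons-+ᵥ a≢1 b≢1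

doubledPlane : PairedArc 26 18
doubledPlane = arc (replicate 13 2)

pattern 18+_ r = suc (suc (suc (suc (suc (suc (suc (suc (suc (suc (suc (suc (suc (suc (suc (suc (suc (suc r)))))))))))))))))

-- Adding the doubled plane raises (n, d) by (26, 18) and keeps n = griesmer d; the base cases 35 and 39
-- are needed because 17 and 21 have no Griesmer arc.
griesmerArc-16+ : ∀ r → r ≢ 1 → r ≢ 5 → PairedArc (griesmer (16 + r)) (16 + r)
griesmerArc-16+ 0 _ _ = arc (2 ∷ 2 ∷ 2 ∷ 2 ∷ 2 ∷ 2 ∷ 2 ∷ 2 ∷ 2 ∷ 2 ∷ 2 ∷ 2 ∷ 0 ∷ [])
griesmerArc-16+ 1 r≢1 _ = contradiction refl r≢1
griesmerArc-16+ 2 _ _ = arc (2 ∷ 2 ∷ 2 ∷ 2 ∷ 2 ∷ 2 ∷ 2 ∷ 2 ∷ 2 ∷ 2 ∷ 2 ∷ 2 ∷ 2 ∷ [])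
griesmerArc-16+ 3 _ _ = arc (3 ∷ 3 ∷ 3 ∷ 0 ∷ 3 ∷ 2 ∷ 2 ∷ 2 ∷ 2 ∷ 3 ∷ 2 ∷ 2 ∷ 2 ∷ [])
griesmerArc-16+ 4 _ _ = arc (3 ∷ 3 ∷ 3 ∷ 0 ∷ 3 ∷ 2 ∷ 2 ∷ 2 ∷ 2 ∷ 3 ∷ 2 ∷ 3 ∷ 2 ∷ [])
griesmerArc-16+ 5 _ r≢5 = contradiction refl r≢5
griesmerArc-16+ 6 _ _ = arc (3 ∷ 3 ∷ 3 ∷ 2 ∷ 3 ∷ 3 ∷ 2 ∷ 3 ∷ 3 ∷ 2 ∷ 2 ∷ 2 ∷ 2 ∷ [])
griesmerArc-16+ 7 _ _ = arc (3 ∷ 3 ∷ 3 ∷ 2 ∷ 3 ∷ 3 ∷ 2 ∷ 3 ∷ 2 ∷ 3 ∷ 2 ∷ 3 ∷ 2 ∷ [])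
griesmerArc-16+ 8 _ _ = arc (3 ∷ 3 ∷ 3 ∷ 2 ∷ 3 ∷ 3 ∷ 2 ∷ 3 ∷ 2 ∷ 3 ∷ 2 ∷ 3 ∷ 3 ∷ [])
griesmerArc-16+ 9 _ _ = arc (3 ∷ 3 ∷ 3 ∷ 3 ∷ 3 ∷ 3 ∷ 3 ∷ 3 ∷ 3 ∷ 3 ∷ 3 ∷ 2 ∷ 2 ∷ [])
griesmerArc-16+ 10 _ _ = arc (3 ∷ 3 ∷ 3 ∷ 3 ∷ 3 ∷ 3 ∷ 3 ∷ 3 ∷ 3 ∷ 3 ∷ 3 ∷ 3 ∷ 2 ∷ [])
griesmerArc-16+ 11 _ _ = arc (3 ∷ 3 ∷ 3 ∷ 3 ∷ 3 ∷ 3 ∷ 3 ∷ 3 ∷ 3 ∷ 3 ∷ 3 ∷ 3 ∷ 3 ∷ [])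
griesmerArc-16+ 12 _ _ = arc (4 ∷ 4 ∷ 4 ∷ 2 ∷ 4 ∷ 4 ∷ 2 ∷ 4 ∷ 3 ∷ 3 ∷ 2 ∷ 3 ∷ 3 ∷ [])
griesmerArc-16+ 13 _ _ = arc (4 ∷ 4 ∷ 4 ∷ 2 ∷ 4 ∷ 4 ∷ 2 ∷ 4 ∷ 2 ∷ 4 ∷ 2 ∷ 4 ∷ 3 ∷ [])
griesmerArc-16+ 14 _ _ = arc (4 ∷ 4 ∷ 4 ∷ 2 ∷ 4 ∷ 4 ∷ 2 ∷ 4 ∷ 2 ∷ 4 ∷ 2 ∷ 4 ∷ 4 ∷ [])
griesmerArc-16+ 15 _ _ = arc (4 ∷ 4 ∷ 4 ∷ 3 ∷ 4 ∷ 4 ∷ 3 ∷ 4 ∷ 4 ∷ 3 ∷ 3 ∷ 3 ∷ 3 ∷ [])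
griesmerArc-16+ 16 _ _ = arc (4 ∷ 4 ∷ 4 ∷ 3 ∷ 4 ∷ 4 ∷ 3 ∷ 4 ∷ 3 ∷ 4 ∷ 3 ∷ 4 ∷ 3 ∷ [])
griesmerArc-16+ 17 _ _ = arc (4 ∷ 4 ∷ 4 ∷ 3 ∷ 4 ∷ 4 ∷ 3 ∷ 4 ∷ 3 ∷ 4 ∷ 3 ∷ 4 ∷ 4 ∷ [])
griesmerArc-16+ (18+ r) _ _ with r ℕ.≟ 1 | r ℕ.≟ 5
... | yes refl | _ = arc (4 ∷ 4 ∷ 4 ∷ 4 ∷ 4 ∷ 4 ∷ 4 ∷ 4 ∷ 4 ∷ 4 ∷ 4 ∷ 4 ∷ 3 ∷ [])
... | no _ | yes refl = arc (5 ∷ 5 ∷ 5 ∷ 3 ∷ 5 ∷ 5 ∷ 3 ∷ 5 ∷ 3 ∷ 5 ∷ 3 ∷ 5 ∷ 5 ∷ [])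
... | no r≢1 | no r≢5 = subst (λ n → PairedArc n (34 + r)) (sym (griesmer-+18 (16 + r)))
                                (doubledPlane ⊕ griesmerArc-16+ r r≢1 r≢5)

griesmerArc : ∀ d → 16 ≤ d → d ≢ 17 → d ≢ 21 → PairedArc (griesmer d) d
griesmerArc d 16≤d d≢17 d≢21 =
  subst (λ e → PairedArc (griesmer e) e) 16+r≡d (griesmerArc-16+ r (d≢17 ∘ d≡16+) (d≢21 ∘ d≡16+))
  where
  r = d ∸ 16
  16+r≡d : 16 + r ≡ d
  16+r≡d = m+[n∸m]≡n 16≤d
  d≡16+ : ∀ {s} → r ≡ s → d ≡ 16 + s
  d≡16+ r≡s = trans (sym 16+r≡d) (cong (16 +_) r≡s)

arc₁ : PairedArc 6 1
arc₁ = arc (2 ∷ 2 ∷ 0 ∷ 0 ∷ 2 ∷ 0 ∷ 0 ∷ 0 ∷ 0 ∷ 0 ∷ 0 ∷ 0 ∷ 0 ∷ [])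

arc₂ : PairedArc 6 2
arc₂ = arc (2 ∷ 2 ∷ 0 ∷ 0 ∷ 2 ∷ 0 ∷ 0 ∷ 0 ∷ 0 ∷ 0 ∷ 0 ∷ 0 ∷ 0 ∷ [])

arc₃ : PairedArc 8 3
arc₃ = arc (2 ∷ 2 ∷ 0 ∷ 0 ∷ 2 ∷ 0 ∷ 0 ∷ 0 ∷ 2 ∷ 0 ∷ 0 ∷ 0 ∷ 0 ∷ [])

arc₄ : PairedArc 8 4
arc₄ = arc (2 ∷ 2 ∷ 0 ∷ 0 ∷ 2 ∷ 0 ∷ 0 ∷ 0 ∷ 2 ∷ 0 ∷ 0 ∷ 0 ∷ 0 ∷ [])

arc₅ : PairedArc 11 5
arc₅ = arc (3 ∷ 3 ∷ 0 ∷ 0 ∷ 3 ∷ 0 ∷ 0 ∷ 0 ∷ 2 ∷ 0 ∷ 0 ∷ 0 ∷ 0 ∷ [])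

arc₆ : PairedArc 12 6
arc₆ = arc (4 ∷ 2 ∷ 0 ∷ 0 ∷ 2 ∷ 0 ∷ 0 ∷ 2 ∷ 0 ∷ 0 ∷ 0 ∷ 2 ∷ 0 ∷ [])

arc₇ : PairedArc 14 7
arc₇ = arc (4 ∷ 3 ∷ 0 ∷ 0 ∷ 3 ∷ 0 ∷ 0 ∷ 0 ∷ 2 ∷ 0 ∷ 0 ∷ 2 ∷ 0 ∷ [])

arc₈ : PairedArc 14 8
arc₈ = arc (2 ∷ 2 ∷ 2 ∷ 0 ∷ 2 ∷ 2 ∷ 0 ∷ 2 ∷ 2 ∷ 0 ∷ 0 ∷ 0 ∷ 0 ∷ [])

arc₉ : PairedArc 16 9
arc₉ = arc (3 ∷ 3 ∷ 0 ∷ 0 ∷ 2 ∷ 2 ∷ 0 ∷ 2 ∷ 2 ∷ 0 ∷ 0 ∷ 0 ∷ 2 ∷ [])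

arc₁₀ : PairedArc 16 10
arc₁₀ = arc (2 ∷ 2 ∷ 2 ∷ 0 ∷ 2 ∷ 2 ∷ 0 ∷ 2 ∷ 0 ∷ 2 ∷ 0 ∷ 2 ∷ 0 ∷ [])

arc₁₁ : PairedArc 18 11
arc₁₁ = arc (3 ∷ 3 ∷ 0 ∷ 0 ∷ 2 ∷ 2 ∷ 0 ∷ 2 ∷ 0 ∷ 2 ∷ 0 ∷ 2 ∷ 2 ∷ [])

arc₁₂ : PairedArc 18 12
arc₁₂ = arc (2 ∷ 2 ∷ 2 ∷ 0 ∷ 2 ∷ 2 ∷ 0 ∷ 2 ∷ 0 ∷ 2 ∷ 0 ∷ 2 ∷ 2 ∷ [])

arc₁₃ : PairedArc 21 13
arc₁₃ = arc (3 ∷ 3 ∷ 2 ∷ 0 ∷ 3 ∷ 2 ∷ 0 ∷ 2 ∷ 0 ∷ 2 ∷ 0 ∷ 2 ∷ 2 ∷ [])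

arc₁₄ : PairedArc 22 14
arc₁₄ = arc (3 ∷ 3 ∷ 2 ∷ 0 ∷ 3 ∷ 2 ∷ 0 ∷ 2 ∷ 0 ∷ 3 ∷ 0 ∷ 2 ∷ 2 ∷ [])

arc₁₅ : PairedArc 24 15
arc₁₅ = arc (4 ∷ 3 ∷ 2 ∷ 0 ∷ 3 ∷ 2 ∷ 0 ∷ 3 ∷ 0 ∷ 2 ∷ 0 ∷ 3 ∷ 2 ∷ [])

arc₁₇ : PairedArc 26 17
arc₁₇ = arc (3 ∷ 3 ∷ 3 ∷ 0 ∷ 3 ∷ 3 ∷ 0 ∷ 3 ∷ 0 ∷ 3 ∷ 0 ∷ 3 ∷ 2 ∷ [])

arc₂₁ : PairedArc 32 21
arc₂₁ = arc (4 ∷ 4 ∷ 3 ∷ 0 ∷ 3 ∷ 2 ∷ 2 ∷ 2 ∷ 2 ∷ 3 ∷ 2 ∷ 3 ∷ 2 ∷ [])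

IsLeast-unique : ∀ {P : ℕ → Set} {m m′} → IsLeast P m → IsLeast P m′ → m ≡ m′
IsLeast-unique {m = m} {m′} (Pm , below-m) (Pm′ , below-m′) with <-cmp m m′
... | tri< m<m′ _ _ = contradiction Pm (below-m′ m m<m′)
... | tri≈ _ m≡m′ _ = m≡m′
... | tri> _ _ m′<m = contradiction Pm′ (below-m m′ m′<m)

optimal : ∀ {n d} → PairedArc n (suc d) → (∀ m → m < n → ¬ LRCExists m 3 (suc d) 1) → n3loc≡ 3 (suc d) 1 n
optimal A shorter = arc⇒LRC (s≤s z≤n) A , shorter

n3loc≡n3 : ∀ d → 16 ≤ d → d ≢ 17 → d ≢ 21 →
  ∀ m → (n3loc≡ 3 d 1 m → n3≡ 3 d m) × (n3≡ 3 d m → n3loc≡ 3 d 1 m)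
n3loc≡n3 d 16≤d d≢17 d≢21 m =
  (λ n3loc≡m → subst (n3≡ 3 d) (IsLeast-unique n3loc≡griesmer n3loc≡m) n3≡griesmer) ,
  (λ n3≡m → subst (n3loc≡ 3 d 1) (IsLeast-unique n3≡griesmer n3≡m) n3loc≡griesmer)
  where
  lrc : LRCExists (griesmer d) 3 d 1
  lrc = arc⇒LRC (≤-trans (s≤s z≤n) 16≤d) (griesmerArc d 16≤d d≢17 d≢21)
  n3loc≡griesmer : n3loc≡ 3 d 1 (griesmer d)
  n3loc≡griesmer = lrc , shorter-than-griesmer
  n3≡griesmer : n3≡ 3 d (griesmer d)
  n3≡griesmer = lrc⇒code lrc , λ n n<g code → <⇒≱ n<g (code⇒griesmer code)

theorem40 : n3loc≡ 3 1 1 6 × n3loc≡ 3 2 1 6 × n3loc≡ 3 3 1 8 × n3loc≡ 3 4 1 8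
            × n3loc≡ 3 5 1 11 × n3loc≡ 3 6 1 12 × n3loc≡ 3 7 1 14 × n3loc≡ 3 8 1 14
            × n3loc≡ 3 9 1 16 × n3loc≡ 3 10 1 16 × n3loc≡ 3 11 1 18 × n3loc≡ 3 12 1 18
            × n3loc≡ 3 13 1 21 × n3loc≡ 3 14 1 22 × n3loc≡ 3 15 1 24
            × n3loc≡ 3 17 1 26 × n3loc≡ 3 21 1 32
            × (∀ (d : ℕ) → 16 ≤ d → d ≢ 17 → d ≢ 21 →
                 ∀ (m : ℕ) → (n3loc≡ 3 d 1 m → n3≡ 3 d m) × (n3≡ 3 d m → n3loc≡ 3 d 1 m))
theorem40 =
  optimal arc₁ (shorter-refuted-by-search 5) , optimal arc₂ (shorter-refuted-by-search 5) ,
  optimal arc₃ (shorter-refuted-by-search 7) , optimal arc₄ (shorter-refuted-by-search 7) ,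
  optimal arc₅ (shorter-refuted-by-search 10) , optimal arc₆ (shorter-refuted-by-search 11) ,
  optimal arc₇ (shorter-refuted-by-search 13) , optimal arc₈ (shorter-refuted-by-search 13) ,
  optimal arc₉ (shorter-refuted-by-search 15) , optimal arc₁₀ shorter-than-griesmer ,
  optimal arc₁₁ (shorter-refuted-by-search 17) , optimal arc₁₂ shorter-than-griesmer ,
  optimal arc₁₃ (shorter-refuted-by-search 20) , optimal arc₁₄ (shorter-refuted-by-search 21) ,
  optimal arc₁₅ (shorter-refuted-by-search 23) , optimal arc₁₇ (shorter-refuted-by-search 25) ,
  optimal arc₂₁ (shorter-refuted-by-search 31) ,
  n3loc≡n3
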